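{- If $2\alpha$ is not a root, then $\tilde n_\alpha(z)\tilde n_\alpha(-z)=1$ for all $z\in E^\times$. If $2\alpha$ is a root, then $\tilde n_{2\alpha}(\ell)\tilde n_{2\alpha}(-\ell)=1$ for all $\ell\in L^\times$.
   Context: Setting: $F$ a field, $\mathbf{G}=R_{L/F}\mathbf{H}$ with $\mathbf{H}$ simply-connected, quasi-split, absolutely almost simple over the finite separable extension $L/F$; $\mathbf{S}$ a maximal $F$-split torus, $\alpha$ an indivisible positive relative root. If $2\alpha\notin\Phi$: central isogeny $\phi_\alpha:R_{E/F}\mathbf{SL}_{2,E}\to\mathbf{G}$ with $e_{\alpha}(u)$, $e_{ -\alpha}(u)$ ($u\in E$) the images of upper/lower unipotent matrices. If $2\alpha\in\Phi$: central isogeny $\phi_\alpha:R_{L/F}\mathbf{SU}_{3,E/L}\to\mathbf{G}$, $E/L$ separable quadratic with nontrivial automorphism $\sigma$; $J_{E/L}=\{(p,\ell)\in E^2:\ell+\ell^\sigma+pp^\sigma=0\}$ (group law $(p_1,\ell_1)(p_2,\ell_2)=(p_1+p_2,\ell_1+\ell_2-p_1^\sigma p_2)$) with homomorphisms $e_{\pm\alpha}:R_{L/F}J_{E/L}\to\mathbf{G}$ onto the root groups; $\theta\in E$ with $\theta+\theta^\sigma=0$ ($\theta=1$ in characteristic 2), and $e_{\pm2\alpha}(\ell)=e_{\pm\alpha}(0,\ell\theta)$, $\ell\in L$. Let $\tilde G$ be a central extension of $G=\mathbf{G}(F)$ by an abelian group with a unipotent splitting, giving homomorphic lifts $\tilde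 e_{\pm\alpha},\tilde e_{\pm2\alpha}$. Put $\tilde n_\alpha(z)=\tilde e_\alpha(z)\tilde e_{ -\alpha}(-z^{ -1})\tilde e_\alpha(z)$ and $\tilde n_{2\alpha}(\ell)=\tilde e_{ -2\alpha}\big(\ell^{ -1}/(\theta\theta^\sigma)\big)\tilde e_{2\alpha}(\ell)\tilde e_{ -2\alpha}\big(\ell^{ -1}/(\theta\theta^\sigma)\big)$. -}

module Defs where

open import Level using (Level; _⊔_) renaming (suc to lsuc)
open import Algebra.Bundles using (CommutativeRing; Group)
open import Relation.Nullary using (¬_)
open import Data.Product using (∃; Σ; _×_)

record Field (c ℓ : Level) : Set (lsuc (c ⊔ ℓ)) where
  field
    commutativeRing : CommutativeRing c ℓ
  open CommutativeRing commutativeRing public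
  field
    0≉1      : ¬ (0# ≈ 1#)
    inv      : (x : Carrier) → ¬ (x ≈ 0#) → Carrier
    inverseʳ : ∀ x (h : ¬ (x ≈ 0#)) → x * inv x h ≈ 1#

record IsFieldHom {c ℓ} (K M : Field c ℓ) (f : Field.Carrier K → Field.Carrier M)
       : Set (c ⊔ ℓ) where
  private
    module K = Field K
    module M = Field M
  field
    cong  : ∀ {x y} → x K.≈ y → f x M.≈ f y
    +-hom : ∀ x y → f (x K.+ y) M.≈ f x M.+ f y
    *-hom : ∀ x y → f (x K.* y) M.≈ f x M.* f y
    1-hom : f K.1# M.≈ M.1#

record IsGroupHom {c ℓ} (A B : Group c ℓ) (f : Group.Carrier A → Group.Carrier B)
       : Set (c ⊔ ℓ) where
  private
    module A = Group A
    module B = Group B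
  field
    cong  : ∀ {x y} → x A.≈ y → f x B.≈ f y
    ∙-hom : ∀ x y → f (x A.∙ y) B.≈ f x B.∙ f y

record IsCentralExtension {c ℓ} (G̃ G : Group c ℓ)
       (π : Group.Carrier G̃ → Group.Carrier G) : Set (c ⊔ ℓ) where
  private
    module G̃ = Group G̃
    module G = Group G
  field
    isHom   : IsGroupHom G̃ G π
    surj    : ∀ g → ∃ λ x → π x G.≈ g
    central : ∀ k → π k G.≈ G.ε → ∀ x → k G̃.∙ x G̃.≈ x G̃.∙ k

record IsAddHom {c ℓ} (E : Field c ℓ) (H : Group c ℓ)
       (f : Field.Carrier E → Group.Carrier H) : Set (c ⊔ ℓ) where
  private
    module E = Field E
    module H = Group H
  field
    cong  : ∀ {x y} → x E.≈ y → f x H.≈ f y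
    +-hom : ∀ x y → f (x E.+ y) H.≈ f x H.∙ f y

nα : ∀ {c ℓ} (E : Field c ℓ) (H : Group c ℓ)
     (eα e₋α : Field.Carrier E → Group.Carrier H)
     (z : Field.Carrier E) → ¬ (Field._≈_ E z (Field.0# E)) → Group.Carrier H
nα E H eα e₋α z h = (eα z ∙ e₋α (- inv z h)) ∙ eα z
  where open Field E using (-_; inv)
        open Group H using (_∙_)

-- Case 2α ∈ Φ.  E/L quadratic with nontrivial automorphism σ.
-- The group J_{E/L}(L) = {(p,ℓ) ∈ E² : ℓ + ℓ^σ + p p^σ = 0} with law
-- (p₁,ℓ₁)(p₂,ℓ₂) = (p₁+p₂, ℓ₁+ℓ₂ - p₁^σ p₂).

JRel : ∀ {c ℓ} (E : Field c ℓ) (σ : Field.Carrier E → Field.Carrier E)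
       (p l : Field.Carrier E) → Set ℓ
JRel E σ p l = (l + σ l) + p * σ p ≈ 0#
  where open Field E

record IsJHom {c ℓ} (E : Field c ℓ) (σ : Field.Carrier E → Field.Carrier E)
       (H : Group c ℓ)
       (f : (p l : Field.Carrier E) → JRel E σ p l → Group.Carrier H)
       : Set (c ⊔ ℓ) where
  private
    module E = Field E
    module H = Group H
  field
    cong : ∀ p l (h : JRel E σ p l) p′ l′ (h′ : JRel E σ p′ l′) →
           p E.≈ p′ → l E.≈ l′ → f p l h H.≈ f p′ l′ h′
    hom  : ∀ p₁ l₁ (h₁ : JRel E σ p₁ l₁) p₂ l₂ (h₂ : JRel E σ p₂ l₂)
             (h₃ : JRel E σ (p₁ E.+ p₂) ((l₁ E.+ l₂) E.- (σ p₁ E.* p₂))) →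
           f p₁ l₁ h₁ H.∙ f p₂ l₂ h₂ H.≈
             f (p₁ E.+ p₂) ((l₁ E.+ l₂) E.- (σ p₁ E.* p₂)) h₃

-- ñ_{2α}(ℓ) = ẽ_{-2α}(c) ẽ_{2α}(ℓ) ẽ_{-2α}(c), where c = ℓ⁻¹/(θθ^σ) ∈ L.
-- Here N ∈ L is the element with ι(N) = θθ^σ, and c = (ℓ N)⁻¹.
n2α : ∀ {c ℓ} (L : Field c ℓ) (H : Group c ℓ)
      (e2α e₋2α : Field.Carrier L → Group.Carrier H)
      (N x : Field.Carrier L) → ¬ (Field._≈_ L (Field._*_ L x N) (Field.0# L)) →
      Group.Carrier H
n2α L H e2α e₋2α N x h =
  (e₋2α (inv (x * N) h) ∙ e2α x) ∙ e₋2α (inv (x * N) h)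
  where open Field L using (_*_; inv)
        open Group H using (_∙_)

{-# OPTIONS --safe #-}
-- Both products are palindromes u v w · w′ v′ u′ in root-group elements whose
-- parameters are pairwise opposite.  The lifts are homomorphisms, so w w′, v v′
-- and u u′ collapse to the identity from the inside out; in the second case
-- ẽ_{±2α} is additive because the points (0, ι(ℓ) θ) of J multiply without a
-- correction term.
module Submission where

open import Defs
open import Algebra.Bundles using (Group)
open import Relation.Nullary using (¬_)
open import Data.Product using (∃; _×_; _,_)
import Algebra.Properties.Group as GroupProperties
import Algebra.Properties.Monoid as MonoidProperties
import Algebra.Properties.Ring as RingProperties
import Relation.Binary.Reasoning.Setoid as SetoidReasoning

module _ {c ℓ} (G : Group c ℓ) where
  open Group G
  open MonoidProperties monoid using (cancelᶜ; cancelˡ)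

  palindrome-inverse : ∀ u v w u′ v′ w′ →
    w ∙ w′ ≈ ε → v ∙ v′ ≈ ε → u ∙ u′ ≈ ε →
    ((u ∙ v) ∙ w) ∙ ((w′ ∙ v′) ∙ u′) ≈ ε
  palindrome-inverse u v w u′ v′ w′ ww′ vv′ uu′ = begin
    ((u ∙ v) ∙ w) ∙ ((w′ ∙ v′) ∙ u′) ≈⟨ ∙-congˡ (assoc w′ v′ u′) ⟩
    ((u ∙ v) ∙ w) ∙ (w′ ∙ (v′ ∙ u′)) ≈⟨ cancelᶜ ww′ (u ∙ v) (v′ ∙ u′) ⟩
    (u ∙ v) ∙ (v′ ∙ u′)              ≈⟨ assoc u v (v′ ∙ u′) ⟩
    u ∙ (v ∙ (v′ ∙ u′))              ≈⟨ ∙-congˡ (cancelˡ vv′ u′) ⟩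
    u ∙ u′                           ≈⟨ uu′ ⟩
    ε                                ∎
    where open SetoidReasoning setoid

module FieldProperties {c ℓ} (F : Field c ℓ) where
  open Field F
  open RingProperties ring using (-‿distribˡ-*; -‿distribʳ-*)
  open GroupProperties +-group using (⁻¹-involutive)
  open SetoidReasoning setoid

  -x*-y≈x*y : ∀ x y → (- x) * (- y) ≈ x * y
  -x*-y≈x*y x y = begin
    (- x) * (- y)  ≈⟨ -‿distribˡ-* x (- y) ⟨
    - (x * - y)    ≈⟨ -‿cong (-‿distribʳ-* x y) ⟨
    - (- (x * y))  ≈⟨ ⁻¹-involutive (x * y) ⟩
    x * y          ∎

  inv-unique : ∀ a u v → a * u ≈ 1# → a * v ≈ 1# → u ≈ v
  inv-unique a u v au≈1 av≈1 = begin
    u            ≈⟨ *-identityʳ u ⟨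
    u * 1#       ≈⟨ *-congˡ av≈1 ⟨
    u * (a * v)  ≈⟨ *-assoc u a v ⟨
    (u * a) * v  ≈⟨ *-congʳ (*-comm u a) ⟩
    (a * u) * v  ≈⟨ *-congʳ au≈1 ⟩
    1# * v       ≈⟨ *-identityˡ v ⟩
    v            ∎

  inv-‿ : ∀ {a b} (a≉0 : ¬ (a ≈ 0#)) (b≉0 : ¬ (b ≈ 0#)) →
          b ≈ - a → inv b b≉0 ≈ - inv a a≉0
  inv-‿ {a} {b} a≉0 b≉0 b≈-a = inv-unique b _ _ (inverseʳ b b≉0) (begin
    b * (- inv a a≉0)      ≈⟨ *-congʳ b≈-a ⟩
    (- a) * (- inv a a≉0)  ≈⟨ -x*-y≈x*y a (inv a a≉0) ⟩
    a * inv a a≉0          ≈⟨ inverseʳ a a≉0 ⟩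
    1#                     ∎)

module _ {c ℓ} {E : Field c ℓ} {H : Group c ℓ} where
  private
    module E = Field E
  open Group H

  map-0 : ∀ {f} → IsAddHom E H f → f E.0# ≈ ε
  map-0 {f} f-hom = GroupProperties.identityˡ-unique H (f E.0#) (f E.0#)
    (trans (sym (+-hom E.0# E.0#)) (cong (E.+-identityˡ E.0#)))
    where open IsAddHom f-hom

  map-‿-inverse : ∀ {f} → IsAddHom E H f → ∀ {a a′} → a′ E.≈ E.- a →
                  f a ∙ f a′ ≈ ε
  map-‿-inverse {f} f-hom {a} {a′} a′≈-a = begin
    f a ∙ f a′      ≈⟨ +-hom a a′ ⟨
    f (a E.+ a′)    ≈⟨ cong (E.trans (E.+-congˡ a′≈-a) (E.-‿inverseʳ a)) ⟩
    f E.0#          ≈⟨ map-0 f-hom ⟩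
    ε               ∎
    where open IsAddHom f-hom
          open SetoidReasoning setoid

  sandwich-inverse : ∀ {f g} → IsAddHom E H f → IsAddHom E H g →
    ∀ {a b a′ b′} → a′ E.≈ E.- a → b′ E.≈ E.- b →
    ((f a ∙ g b) ∙ f a) ∙ ((f a′ ∙ g b′) ∙ f a′) ≈ ε
  sandwich-inverse f-hom g-hom a′≈-a b′≈-b =
    palindrome-inverse H _ _ _ _ _ _
      (map-‿-inverse f-hom a′≈-a) (map-‿-inverse g-hom b′≈-b) (map-‿-inverse f-hom a′≈-a)

module JHomProperties {c ℓ} {E : Field c ℓ} {σ : Field.Carrier E → Field.Carrier E}
                      (σ-hom : IsFieldHom E E σ) where
  open Field E
  open GroupProperties +-group using (ε⁻¹≈ε)
  private
    module σ = IsFieldHom σ-hom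

  JRel-resp : ∀ {p l p′ l′} → p ≈ p′ → l ≈ l′ → JRel E σ p l → JRel E σ p′ l′
  JRel-resp p≈p′ l≈l′ = trans
    (sym (+-cong (+-cong l≈l′ (σ.cong l≈l′)) (*-cong p≈p′ (σ.cong p≈p′))))

  module _ {H : Group c ℓ} {f : (p l : Carrier) → JRel E σ p l → Group.Carrier H}
           (f-hom : IsJHom E σ H f) where
    open Group H using (_∙_) renaming (_≈_ to _≈ᴴ_; trans to transᴴ)
    open IsJHom f-hom

    map-0-+ : ∀ {l₁ l₂} (h₁ : JRel E σ 0# l₁) (h₂ : JRel E σ 0# l₂)
              (h : JRel E σ 0# (l₁ + l₂)) →
              f 0# l₁ h₁ ∙ f 0# l₂ h₂ ≈ᴴ f 0# (l₁ + l₂) h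
    map-0-+ {l₁} {l₂} h₁ h₂ h =
      transᴴ (hom 0# l₁ h₁ 0# l₂ h₂ h₃) (cong _ _ h₃ _ _ h (+-identityˡ 0#) no-correction)
      where
      no-correction : (l₁ + l₂) - (σ 0# * 0#) ≈ l₁ + l₂
      no-correction = trans (+-congˡ (trans (-‿cong (zeroʳ (σ 0#))) ε⁻¹≈ε)) (+-identityʳ _)
      h₃ : JRel E σ (0# + 0#) ((l₁ + l₂) - (σ 0# * 0#))
      h₃ = JRel-resp (sym (+-identityˡ 0#)) (sym no-correction) h

module _ {c ℓ} {L E : Field c ℓ}
         {ι : Field.Carrier L → Field.Carrier E} (ι-hom : IsFieldHom L E ι)
         {σ : Field.Carrier E → Field.Carrier E} (σ-hom : IsFieldHom E E σ)
         (σ-fixes-ι : ∀ y → Field._≈_ E (σ (ι y)) (ι y))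
         {θ : Field.Carrier E} (θ-traceless : Field._≈_ E (Field._+_ E θ (σ θ)) (Field.0# E))
         where
  open Field E
  private
    module L = Field L
    module ι = IsFieldHom ι-hom
    module σ = IsFieldHom σ-hom

  ιθ-JRel : ∀ y → JRel E σ 0# (ι y * θ)
  ιθ-JRel y = begin
    (ι y * θ + σ (ι y * θ)) + 0# * σ 0#  ≈⟨ +-cong (+-congˡ σ-ιθ) (zeroˡ (σ 0#)) ⟩
    (ι y * θ + ι y * σ θ) + 0#           ≈⟨ +-identityʳ _ ⟩
    ι y * θ + ι y * σ θ                  ≈⟨ distribˡ (ι y) θ (σ θ) ⟨
    ι y * (θ + σ θ)                      ≈⟨ *-congˡ θ-traceless ⟩
    ι y * 0#                             ≈⟨ zeroʳ (ι y) ⟩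
    0#                                   ∎
    where
    open SetoidReasoning setoid
    σ-ιθ : σ (ι y * θ) ≈ ι y * σ θ
    σ-ιθ = trans (σ.*-hom (ι y) θ) (*-congʳ (σ-fixes-ι y))

  restriction-isAddHom : ∀ {H : Group c ℓ}
    {f : (p l : Carrier) → JRel E σ p l → Group.Carrier H} → IsJHom E σ H f →
    (g : L.Carrier → Group.Carrier H) →
    (∀ y (h : JRel E σ 0# (ι y * θ)) → Group._≈_ H (g y) (f 0# (ι y * θ) h)) →
    IsAddHom L H g
  restriction-isAddHom {H} {f} f-hom g g≈f = record
    { cong  = λ {x} {y} x≈y → begin
        g x                     ≈⟨ g≈f x (ιθ-JRel x) ⟩
        f 0# (ι x * θ) _        ≈⟨ f.cong _ _ _ _ _ _ refl (*-congʳ (ι.cong x≈y)) ⟩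
        f 0# (ι y * θ) _        ≈⟨ g≈f y (ιθ-JRel y) ⟨
        g y                     ∎
    ; +-hom = λ x y → begin
        g (x L.+ y)                                 ≈⟨ g≈f (x L.+ y) (ιθ-JRel (x L.+ y)) ⟩
        f 0# (ι (x L.+ y) * θ) _                    ≈⟨ f.cong _ _ _ _ _ _ refl ι-distrib ⟩
        f 0# (ι x * θ + ι y * θ) (sum-JRel x y)     ≈⟨ map-0-+ f-hom (ιθ-JRel x) (ιθ-JRel y) _ ⟨
        f 0# (ι x * θ) _ ∙ f 0# (ι y * θ) _         ≈⟨ ∙-cong (g≈f x (ιθ-JRel x)) (g≈f y (ιθ-JRel y)) ⟨
        g x ∙ g y                                   ∎
    }
    where
    open Group H using (_∙_; ∙-cong)
    open SetoidReasoning (Group.setoid H)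
    open JHomProperties σ-hom using (JRel-resp; map-0-+)
    module f = IsJHom f-hom
    ι-distrib : ∀ {x y} → ι (x L.+ y) * θ ≈ ι x * θ + ι y * θ
    ι-distrib {x} {y} = trans (*-congʳ (ι.+-hom x y)) (distribʳ θ (ι x) (ι y))
    sum-JRel : ∀ x y → JRel E σ 0# (ι x * θ + ι y * θ)
    sum-JRel x y = JRel-resp refl ι-distrib (ιθ-JRel (x L.+ y))

mainTheorem9 : ∀ {c ℓ} →
    -- Case 2α ∉ Φ
    ( (E : Field c ℓ) (G̃ G : Group c ℓ)
      (π : Group.Carrier G̃ → Group.Carrier G) → IsCentralExtension G̃ G π →
      (eα e₋α : Field.Carrier E → Group.Carrier G) →
      IsAddHom E G eα → IsAddHom E G e₋α →
      (ẽα ẽ₋α : Field.Carrier E → Group.Carrier G̃) →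
      IsAddHom E G̃ ẽα → IsAddHom E G̃ ẽ₋α →
      (∀ z → Group._≈_ G (π (ẽα z)) (eα z)) →
      (∀ z → Group._≈_ G (π (ẽ₋α z)) (e₋α z)) →
      ∀ z (h : ¬ (Field._≈_ E z (Field.0# E)))
          (h′ : ¬ (Field._≈_ E (Field.-_ E z) (Field.0# E))) →
      Group._≈_ G̃
        (Group._∙_ G̃ (nα E G̃ ẽα ẽ₋α z h) (nα E G̃ ẽα ẽ₋α (Field.-_ E z) h′))
        (Group.ε G̃) )
    ×
    -- Case 2α ∈ Φ
    ( (L E : Field c ℓ)
      (ι : Field.Carrier L → Field.Carrier E) → IsFieldHom L E ι →
      (σ : Field.Carrier E → Field.Carrier E) → IsFieldHom E E σ →
      (∀ x → Field._≈_ E (σ (σ x)) x) →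
      (∃ λ x → ¬ (Field._≈_ E (σ x) x)) →
      (∀ y → Field._≈_ E (σ (ι y)) (ι y)) →
      (∀ x → Field._≈_ E (σ x) x → ∃ λ y → Field._≈_ E (ι y) x) →
      (θ : Field.Carrier E) →
      Field._≈_ E (Field._+_ E θ (σ θ)) (Field.0# E) →
      ¬ (Field._≈_ E θ (Field.0# E)) →
      (Field._≈_ E (Field._+_ E (Field.1# E) (Field.1# E)) (Field.0# E) →
        Field._≈_ E θ (Field.1# E)) →
      (G̃ G : Group c ℓ)
      (π : Group.Carrier G̃ → Group.Carrier G) → IsCentralExtension G̃ G π →
      (eα e₋α : (p l : Field.Carrier E) → JRel E σ p l → Group.Carrier G) →
      IsJHom E σ G eα → IsJHom E σ G e₋α →
      (ẽα ẽ₋α : (p l : Field.Carrier E) → JRel E σ p l → Group.Carrier G̃) →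
      IsJHom E σ G̃ ẽα → IsJHom E σ G̃ ẽ₋α →
      (∀ p l h → Group._≈_ G (π (ẽα p l h)) (eα p l h)) →
      (∀ p l h → Group._≈_ G (π (ẽ₋α p l h)) (e₋α p l h)) →
      (ẽ2α ẽ₋2α : Field.Carrier L → Group.Carrier G̃) →
      (∀ x (h : JRel E σ (Field.0# E) (Field._*_ E (ι x) θ)) →
        Group._≈_ G̃ (ẽ2α x) (ẽα (Field.0# E) (Field._*_ E (ι x) θ) h)) →
      (∀ x (h : JRel E σ (Field.0# E) (Field._*_ E (ι x) θ)) →
        Group._≈_ G̃ (ẽ₋2α x) (ẽ₋α (Field.0# E) (Field._*_ E (ι x) θ) h)) →
      (N : Field.Carrier L) → Field._≈_ E (ι N) (Field._*_ E θ (σ θ)) →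
      ∀ x (h : ¬ (Field._≈_ L (Field._*_ L x N) (Field.0# L)))
          (h′ : ¬ (Field._≈_ L (Field._*_ L (Field.-_ L x) N) (Field.0# L))) →
      Group._≈_ G̃
        (Group._∙_ G̃ (n2α L G̃ ẽ2α ẽ₋2α N x h)
                     (n2α L G̃ ẽ2α ẽ₋2α N (Field.-_ L x) h′))
        (Group.ε G̃) )

mainTheorem9 =
  (λ E _ _ _ _ _ _ _ _ _ _ ẽα-hom ẽ₋α-hom _ _ z z≉0 -z≉0 →
    let open Field E
        open FieldProperties E
    in sandwich-inverse ẽα-hom ẽ₋α-hom refl (-‿cong (inv-‿ z≉0 -z≉0 refl)))
  ,
  (λ L E ι ι-hom σ σ-hom _ _ σ-fixes-ι _ θ θ-traceless _ _ _ _ _ _ _ _ _ _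
     ẽα ẽ₋α ẽα-hom ẽ₋α-hom _ _ ẽ2α ẽ₋2α ẽ2α≈ẽα ẽ₋2α≈ẽ₋α N _ x xN≉0 -xN≉0 →
    let open Field L
        open FieldProperties L
        open RingProperties ring using (-‿distribˡ-*)
    in sandwich-inverse
         (restriction-isAddHom ι-hom σ-hom σ-fixes-ι θ-traceless ẽ₋α-hom ẽ₋2α ẽ₋2α≈ẽ₋α)
         (restriction-isAddHom ι-hom σ-hom σ-fixes-ι θ-traceless ẽα-hom ẽ2α ẽ2α≈ẽα)
         (inv-‿ xN≉0 -xN≉0 (sym (-‿distribˡ-* x N))) refl)
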